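{- Let $G$ be a subgroup of $S_\infty$ and let $i:G\to[T_G]$ be the map $i(g)=g(0)g^{ -1}(0)g(1)g^{ -1}(1)\cdots$. Then $i$ is a bijection if and only if $i(G)$ is a closed subset of $[T_G]$.
   Context: $S_\infty$ is the group of all permutations of $\mathbb{N}$. For a subgroup $G\le S_\infty$, $T_G\subseteq\mathbb{N}^{<\omega}$ is the tree of all strings of the form $g(0)g^{ -1}(0)g(1)g^{ -1}(1)\cdots g(n)g^{ -1}(n)$ with $g\in G$, $n\in\mathbb{N}$, ordered by initial segment. $[T_G]$ is the set of infinite paths through $T_G$ (elements $f\in\mathbb{N}^\omega$ all of whose finite initial segments lie in $T_G$), with the product topology whose basic clopen sets are $\{f:\tau\sqsubset f\}$ for $\tau\in T_G$. -}

module Defs where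

open import Data.Nat using (ℕ; zero; suc)
open import Data.List using (List; []; _∷_; length)
open import Data.Product using (Σ; _×_; ∃; _,_)
open import Relation.Binary.PropositionalEquality using (_≡_)
open import Function using (_∘_)

record Perm : Set where
  field
    to      : ℕ → ℕ
    from    : ℕ → ℕ
    from∘to : ∀ n → from (to n) ≡ n
    to∘from : ∀ n → to (from n) ≡ n
open Perm public

_≈ₚ_ : Perm → Perm → Set
g ≈ₚ h = ∀ n → to g n ≡ to h n

idₚ : Perm
idₚ = record { to = λ n → n ; from = λ n → n
             ; from∘to = λ n → Relation.Binary.PropositionalEquality.refl
             ; to∘from = λ n → Relation.Binary.PropositionalEquality.refl }

_∘ₚ_ : Perm → Perm → Perm
g ∘ₚ h = record { to = to g ∘ to h ; from = from h ∘ from g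
                ; from∘to = λ n → trans (cong (from h) (from∘to g (to h n))) (from∘to h n)
                ; to∘from = λ n → trans (cong (to g) (to∘from h (from g n))) (to∘from g n) }
  where open Relation.Binary.PropositionalEquality using (trans; cong)

_⁻¹ₚ : Perm → Perm
g ⁻¹ₚ = record { to = from g ; from = to g ; from∘to = to∘from g ; to∘from = from∘to g }

-- A subgroup of S∞, given as a predicate on permutations (respecting equality of
-- permutations, so that it is a genuine subset of S∞).
record Subgroup : Set₁ where
  field
    Mem      : Perm → Set
    resp     : ∀ {g h} → g ≈ₚ h → Mem g → Mem h
    has-id   : Mem idₚ
    closed-∘ : ∀ {g h} → Mem g → Mem h → Mem (g ∘ₚ h)
    closed-⁻¹ : ∀ {g} → Mem g → Mem (g ⁻¹ₚ)
open Subgroup public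

-- interleave f h = f 0, h 0, f 1, h 1, ...
interleave : (ℕ → ℕ) → (ℕ → ℕ) → ℕ → ℕ
interleave f h zero    = f 0
interleave f h (suc k) = interleave h (f ∘ suc) k

iseq : Perm → ℕ → ℕ
iseq g = interleave (to g) (from g)

prefix : (ℕ → ℕ) → ℕ → List ℕ
prefix f zero    = []
prefix f (suc n) = f 0 ∷ prefix (f ∘ suc) n

-- T_G (closed under initial segments): the finite initial segments of the i(g), g ∈ G
InT : Subgroup → List ℕ → Set
InT G τ = Σ Perm λ g → Mem G g × (τ ≡ prefix (iseq g) (length τ))

InPaths : Subgroup → (ℕ → ℕ) → Set
InPaths G f = ∀ n → InT G (prefix f n)

InImage : Subgroup → (ℕ → ℕ) → Set
InImage G f = Σ Perm λ g → Mem G g × (∀ k → iseq g k ≡ f k)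

-- C ⊆ [T_G] is closed in [T_G] (product topology, basic open sets {f : τ ⊏ f}):
-- every f ∈ [T_G] each of whose basic neighbourhoods meets C lies in C.
IsClosedIn : Subgroup → ((ℕ → ℕ) → Set) → Set
IsClosedIn G C = ∀ f → InPaths G f →
  (∀ n → Σ (ℕ → ℕ) λ c → C c × (prefix c n ≡ prefix f n)) → C f

IsBijection-i : Subgroup → Set
IsBijection-i G =
  (∀ g h → Mem G g → Mem G h → (∀ k → iseq g k ≡ iseq h k) → g ≈ₚ h)
  × (∀ f → InPaths G f → InImage G f)

{-# OPTIONS --safe #-}
module Submission where

-- Idea: i is always injective, because g(n) is the (2n)-th entry of i(g); and
-- i(G) is always dense in [T_G], because every node of T_G is an initial segment
-- of some i(g).  Hence i is a bijection iff i(G) = [T_G] iff i(G) is closed.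

open import Defs
open import Function using (_∘_)
open import Function.Bundles using (_⇔_; mk⇔)
open import Data.Nat using (ℕ; zero; suc; _+_)
open import Data.Nat.Properties using (+-suc)
open import Data.List using (length)
open import Data.Product using (Σ; _×_; _,_)
open import Relation.Binary.PropositionalEquality using (_≡_; refl; sym; trans; cong)
open Relation.Binary.PropositionalEquality.≡-Reasoning

InClosure : ((ℕ → ℕ) → Set) → (ℕ → ℕ) → Set
InClosure C f = ∀ n → Σ (ℕ → ℕ) λ c → C c × (prefix c n ≡ prefix f n)

length-prefix : ∀ (f : ℕ → ℕ) n → length (prefix f n) ≡ n
length-prefix f zero    = refl
length-prefix f (suc n) = cong suc (length-prefix (f ∘ suc) n)

interleave-even : ∀ (f h : ℕ → ℕ) n → interleave f h (n + n) ≡ f n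
interleave-even f h zero    = refl
interleave-even f h (suc n) rewrite +-suc n n = interleave-even (f ∘ suc) (h ∘ suc) n

iseq-injective : ∀ g h → (∀ k → iseq g k ≡ iseq h k) → g ≈ₚ h
iseq-injective g h same n = begin
  to g n               ≡⟨ sym (interleave-even (to g) (from g) n) ⟩
  iseq g (n + n)       ≡⟨ same (n + n) ⟩
  iseq h (n + n)       ≡⟨ interleave-even (to h) (from h) n ⟩
  to h n               ∎

paths⊆closure-image : ∀ G {f} → InPaths G f → InClosure (InImage G) f
paths⊆closure-image G {f} path n with path n
... | g , g∈G , f↾n≡ =
  iseq g , (g , g∈G , λ _ → refl) ,
  sym (trans f↾n≡ (cong (prefix (iseq g)) (length-prefix f n)))

proposition1 : (G : Subgroup) → IsBijection-i G ⇔ IsClosedIn G (InImage G)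
proposition1 G = mk⇔ closed bijective
  where
  closed : IsBijection-i G → IsClosedIn G (InImage G)
  closed (_ , surjective) f path _ = surjective f path

  bijective : IsClosedIn G (InImage G) → IsBijection-i G
  bijective isClosed =
    (λ g h _ _ → iseq-injective g h) ,
    (λ f path → isClosed f path (paths⊆closure-image G path))
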